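{- Let $g\ge4$ be even and let $m=\frac{g^g-1}{g-1}=1+g+\dots+g^{g-1}$ (the number whose base-$g$ expansion consists of $g$ ones). Then $m$ is primitive. The integer $x_0=\sum_{j=1}^{g-1} j\,g^{g-1-j}$ (whose base-$g$ digits are $1,2,\dots,g-1$) is a point of an extreme cycle for $\{0,m\}$ of length $g$, and the extreme cycle containing $x_0$ is the only non-trivial extreme cycle for $\{0,m\}$.
   Context: For an odd integer $m\ge1$, an extreme cycle for the digit set $\{0,m\}$ (with respect to the even integer $g\ge4$) is a finite set of distinct integers $\{x_0,\dots,x_{r-1}\}$ together with digits $l_0,\dots,l_{r-1}\in\{0,m\}$ such that $x_{j+1}=(x_j+l_j)/g$ for $0\le j\le r-2$ and $x_0=(x_{r-1}+l_{r-1})/g$; its length is $r$. The cycle $\{0\}$ is the trivial extreme cycle. $m$ is complete if the only extreme cycle for $\{0,m\}$ is the trivial one, and incomplete otherwise. An odd number $m$ is primitive if it is incomplete and every proper divisor of $m$ is complete. -}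

module Defs where

open import Data.Nat using (ℕ; zero; suc; _+_; _*_; _∸_; _^_; _<?_; s≤s)
open import Data.Nat.Divisibility using (_∣_)
open import Data.Integer as ℤ using (ℤ; +_)
open import Data.Fin using (Fin; zero; suc; toℕ; fromℕ<)
open import Data.Product using (Σ; ∃; _×_; _,_)
open import Data.Sum using (_⊎_)
open import Relation.Binary.PropositionalEquality using (_≡_; _≢_)
open import Relation.Nullary using (¬_; yes; no)
open import Function.Definitions using (Injective)

sumBelow : ℕ → (ℕ → ℕ) → ℕ
sumBelow zero    f = 0
sumBelow (suc n) f = sumBelow n f + f n

repunit : ℕ → ℕ
repunit g = sumBelow g (λ j → g ^ j)

-- x₀ = Σ_{j=1}^{g-1} j g^(g-1-j)   (the j = 0 term is 0)
x₀ : ℕ → ℕ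
x₀ g = sumBelow g (λ j → j * g ^ (g ∸ 1 ∸ j))

next : ∀ {n} → Fin n → Fin n
next {suc n} i with suc (toℕ i) <? suc n
... | yes p = fromℕ< p
... | no  _ = zero

-- An extreme cycle for the digit set {0,m} w.r.t. base g, of length r = suc k ≥ 1:
-- distinct integers x_0..x_{r-1}, digits l_j ∈ {0,m}, with g·x_{j+1} = x_j + l_j
-- (indices mod r), i.e. x_{j+1} = (x_j + l_j)/g as an exact division.
record ExtremeCycle (g m : ℕ) : Set where
  field
    k     : ℕ
    x     : Fin (suc k) → ℤ
    l     : Fin (suc k) → ℤ
    digit : ∀ i → l i ≡ + 0 ⊎ l i ≡ + m
    dist  : Injective _≡_ _≡_ x
    step  : ∀ i → + g ℤ.* x (next i) ≡ x i ℤ.+ l i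

  length : ℕ
  length = suc k

open ExtremeCycle public

_∈C_ : ∀ {g m} → ℤ → ExtremeCycle g m → Set
y ∈C C = ∃ λ i → x C i ≡ y

Trivial : ∀ {g m} → ExtremeCycle g m → Set
Trivial C = ∀ i → x C i ≡ + 0

Complete : ℕ → ℕ → Set
Complete g m = ∀ (C : ExtremeCycle g m) → Trivial C

Incomplete : ℕ → ℕ → Set
Incomplete g m = Σ (ExtremeCycle g m) λ C → ¬ Trivial C

Primitive : ℕ → ℕ → Set
Primitive g m = Incomplete g m × (∀ d → d ∣ m → d ≢ m → Complete g d)

-- Every point of an extreme cycle for {0, d} in base g = h + 1 is a natural number n with
-- h·n ≤ d. For d = m = (g^g − 1)/h, following the cycle for g steps shows that h·n is a
-- g-digit base-g number with digits 0 and 1, recording which digits (0 or m) the cycle uses.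
-- Since g ≡ 1 (mod h) the digit sum is divisible by h, and it is at most g < 2h; so either
-- n = 0, or exactly one digit k is 0 and n = q k := (m − g^k)/h. The numbers q 0, …, q h form
-- one cycle (q (k + 1) ↦ q k with digit m, q 0 ↦ q h with digit 0) containing x₀ = q 1, hence
-- every nontrivial cycle is this one. A cycle for a proper divisor d of m, multiplied by m/d,
-- is a cycle for m; its points cannot be some q k, as m/d would divide g^k while being
-- coprime to g.

module Submission where

open import Defs
open import Data.Nat
open import Data.Nat.Properties
open import Data.Nat.DivMod using (_%_; m<n⇒m%n≡m; [m+kn]%n≡m%n)
open import Data.Nat.Divisibility using (_∣_; divides; ∣m+n∣m⇒∣n; ∣n⇒∣m*n; m∣m*n; ∣-trans; ∣1⇒≡1)
open import Data.Nat.Coprimality using (Coprime; coprime-divisor)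
open import Data.Nat.GeneralisedArithmetic using (fold)
open import Data.Nat.Tactic.RingSolver using (solve)
open import Data.Integer as ℤ using (ℤ; +_; ∣_∣)
import Data.Integer.Properties as ℤP
import Data.Integer.Tactic.RingSolver as ℤSolver
open import Data.Fin using (Fin; zero; suc; toℕ; fromℕ; fromℕ<; inject₁)
open import Data.Fin.Properties using (toℕ-fromℕ<; toℕ-fromℕ; toℕ-inject₁; toℕ-injective; toℕ<n)
open import Data.List.Base using ([]; _∷_; allFin)
open import Data.List.Relation.Unary.All as All using ()
open import Data.List.Membership.Propositional.Properties using (∈-allFin)
open import Data.List.Extrema ℤP.≤-totalOrder using (argmax; argmin; f[xs]≤f[argmax]; f[argmin]≤f[xs])
open import Data.Product using (Σ; ∃; ∃-syntax; _×_; _,_)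
open import Data.Sum as Sum using (_⊎_; inj₁; inj₂; [_,_]′)
open import Function.Base using (id; _∘_)
open import Function.Bundles using (_⇔_; mk⇔)
open import Relation.Nullary using (¬_; yes; no; contradiction)
open import Relation.Binary.Definitions using (tri<; tri≈; tri>)
open import Relation.Binary.PropositionalEquality

next-spec : ∀ {n} (i : Fin (suc n)) →
            toℕ (next i) ≡ suc (toℕ i) ⊎ (toℕ i ≡ n × next i ≡ zero)
next-spec {n} i with suc (toℕ i) <? suc n
... | yes p = inj₁ (toℕ-fromℕ< p)
... | no ¬p = inj₂ (≤-antisym (≤-pred (toℕ<n i)) (≮⇒≥ (¬p ∘ s≤s)) , refl)

next-surjective : ∀ {n} (i : Fin (suc n)) → ∃ λ p → next p ≡ i
next-surjective {n} zero with next-spec (fromℕ n)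
... | inj₁ e        = contradiction (subst (_< suc n) (trans e (cong suc (toℕ-fromℕ n))) (toℕ<n _)) (<-irrefl refl)
... | inj₂ (_ , e)  = fromℕ n , e
next-surjective {suc n} (suc j) with next-spec (inject₁ j)
... | inj₁ e        = inject₁ j , toℕ-injective (trans e (cong suc (toℕ-inject₁ j)))
... | inj₂ (e , _)  = contradiction (toℕ<n j) (<-irrefl (trans (sym (toℕ-inject₁ j)) e))

next-fixed⇒unique : ∀ {n} {i : Fin (suc n)} → next i ≡ i → ∀ j → j ≡ i
next-fixed⇒unique {n} {i} fixed j with next-spec i
... | inj₁ e = contradiction (sym (trans (cong toℕ (sym fixed)) e)) 1+n≢n
... | inj₂ (i≡n , next-i≡0) = toℕ-injective (trans toℕj≡0 (sym toℕi≡0))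
  where
  toℕi≡0 : toℕ i ≡ 0
  toℕi≡0 = cong toℕ (trans (sym fixed) next-i≡0)
  toℕj≡0 : toℕ j ≡ 0
  toℕj≡0 = n≤0⇒n≡0 (subst (toℕ j ≤_) (trans (sym i≡n) toℕi≡0) (≤-pred (toℕ<n j)))

maximum-attained : ∀ {n} (f : Fin (suc n) → ℤ) → ∃ λ a → ∀ j → f j ℤ.≤ f a
maximum-attained {n} f =
  argmax f zero (allFin _) , λ j → All.lookup (f[xs]≤f[argmax] {f = f} zero (allFin (suc n))) (∈-allFin j)

minimum-attained : ∀ {n} (f : Fin (suc n) → ℤ) → ∃ λ a → ∀ j → f a ℤ.≤ f j
minimum-attained {n} f =
  argmin f zero (allFin _) , λ j → All.lookup (f[argmin]≤f[xs] {f = f} zero (allFin (suc n))) (∈-allFin j)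

term≤sumBelow : ∀ f {k n} → k < n → f k ≤ sumBelow n f
term≤sumBelow f {n = suc n} k<1+n with m<1+n⇒m<n∨m≡n k<1+n
... | inj₁ k<n  = ≤-trans (term≤sumBelow f k<n) (m≤m+n _ _)
... | inj₂ refl = m≤n+m _ _

mod-unique : ∀ {a b} n .{{_ : NonZero n}} x y → a < n → b < n → a + x * n ≡ b + y * n → a ≡ b
mod-unique {a} {b} n x y a<n b<n eq = begin
  a                ≡⟨ m<n⇒m%n≡m a<n ⟨
  a % n            ≡⟨ [m+kn]%n≡m%n a x n ⟨
  (a + x * n) % n  ≡⟨ cong (_% n) eq ⟩
  (b + y * n) % n  ≡⟨ [m+kn]%n≡m%n b y n ⟩
  b % n            ≡⟨ m<n⇒m%n≡m b<n ⟩
  b                ∎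
  where open ≡-Reasoning

coprime-∣^⇒∣1 : ∀ {e c} → Coprime e c → ∀ t → e ∣ c ^ t → e ∣ 1
coprime-∣^⇒∣1 coprime zero    e∣1      = e∣1
coprime-∣^⇒∣1 coprime (suc t) e∣c^1+t = coprime-∣^⇒∣1 coprime t (coprime-divisor coprime e∣c^1+t)

^-injective : ∀ g → 1 < g → ∀ {j k} → g ^ j ≡ g ^ k → j ≡ k
^-injective g 1<g {j} {k} eq with <-cmp j k
... | tri< j<k _ _ = contradiction eq (<⇒≢ (^-monoʳ-< g 1<g j<k))
... | tri≈ _ j≡k _ = j≡k
... | tri> _ _ k<j = contradiction (sym eq) (<⇒≢ (^-monoʳ-< g 1<g k<j))

∸-suc : ∀ {m n} → n < m → m ∸ n ≡ suc (m ∸ suc n)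
∸-suc {suc m} {zero}  _         = refl
∸-suc {suc m} {suc n} (s≤s n<m) = ∸-suc n<m

h∣s≤1+h⇒s≡0∨s≡h : ∀ {h s} → 2 ≤ h → h ∣ s → s ≤ suc h → s ≡ 0 ⊎ s ≡ h
h∣s≤1+h⇒s≡0∨s≡h         _   (divides 0 refl)        _      = inj₁ refl
h∣s≤1+h⇒s≡0∨s≡h {h}     _   (divides 1 refl)        _      = inj₂ (+-identityʳ h)
h∣s≤1+h⇒s≡0∨s≡h {h} 2≤h (divides (2+ t) refl) s≤1+h = contradiction 2≤1 λ { (s≤s ()) }
  where
  h+t*h≤1 : h + t * h ≤ 1
  h+t*h≤1 = +-cancelˡ-≤ h (h + t * h) 1 (subst (h + (h + t * h) ≤_) (+-comm 1 h) s≤1+h)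
  2≤1 : 2 ≤ 1
  2≤1 = ≤-trans 2≤h (≤-trans (m≤m+n h (t * h)) h+t*h≤1)

+-cancelˡ-≤ℤ : ∀ i {j k} → i ℤ.+ j ℤ.≤ i ℤ.+ k → j ℤ.≤ k
+-cancelˡ-≤ℤ i {j} {k} le = subst₂ ℤ._≤_ (cancel j) (cancel k) (ℤP.+-monoʳ-≤ (ℤ.- i) le)
  where
  cancel : ∀ t → ℤ.- i ℤ.+ (i ℤ.+ t) ≡ t
  cancel t = ℤSolver.solve (i ∷ t ∷ [])

Bits : (ℕ → ℕ) → Set
Bits b = ∀ j → b j ≤ 1

digitSum≤length : ∀ {b} → Bits b → ∀ n → sumBelow n b ≤ n
digitSum≤length     bits zero    = z≤n
digitSum≤length {b} bits (suc n) = subst (sumBelow n b + b n ≤_) (+-comm n 1) (+-mono-≤ (digitSum≤length bits n) (bits n))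

-- Arithmetic in base g = h + 1, chosen so that g ≡ 1 (mod h); rep n is the n-digit repunit.
module Radix (h : ℕ) where

  g : ℕ
  g = suc h

  rep : ℕ → ℕ
  rep n = sumBelow n (λ j → g ^ j)

  rep-suc : ∀ n → rep (suc n) ≡ 1 + g * rep n
  rep-suc zero    = cong suc (sym (*-zeroʳ g))
  rep-suc (suc n) = begin
    rep (suc n) + g ^ suc n    ≡⟨ cong (_+ g ^ suc n) (rep-suc n) ⟩
    1 + g * rep n + g * g ^ n  ≡⟨ cong suc (*-distribˡ-+ g (rep n) (g ^ n)) ⟨
    1 + g * (rep n + g ^ n)    ∎
    where open ≡-Reasoning

  ^≡1+h*rep : ∀ n → g ^ n ≡ 1 + h * rep n
  ^≡1+h*rep zero    = cong suc (sym (*-zeroʳ h))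
  ^≡1+h*rep (suc n) = begin
    g ^ n + h * g ^ n          ≡⟨ cong (_+ h * g ^ n) (^≡1+h*rep n) ⟩
    1 + h * rep n + h * g ^ n  ≡⟨ cong suc (*-distribˡ-+ h (rep n) (g ^ n)) ⟨
    1 + h * (rep n + g ^ n)    ∎
    where open ≡-Reasoning

  rep≡n+h*sumBelow-rep : ∀ n → rep n ≡ n + h * sumBelow n rep
  rep≡n+h*sumBelow-rep zero    = sym (*-zeroʳ h)
  rep≡n+h*sumBelow-rep (suc n) = begin
    rep n + g ^ n                               ≡⟨ cong₂ _+_ (rep≡n+h*sumBelow-rep n) (^≡1+h*rep n) ⟩
    (n + h * sumBelow n rep) + (1 + h * rep n)  ≡⟨ regroup n (sumBelow n rep) (rep n) ⟩
    suc n + h * (sumBelow n rep + rep n)        ∎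
    where
    open ≡-Reasoning
    regroup : ∀ n s r → (n + h * s) + (1 + h * r) ≡ suc n + h * (s + r)
    regroup n s r = solve (h ∷ n ∷ s ∷ r ∷ [])

  ascending : ℕ → ℕ
  ascending zero    = 0
  ascending (suc n) = g * ascending n + n

  h*ascending+n≡rep : ∀ n → h * ascending n + n ≡ rep n
  h*ascending+n≡rep zero    = trans (+-identityʳ (h * 0)) (*-zeroʳ h)
  h*ascending+n≡rep (suc n) = begin
    h * (g * ascending n + n) + suc n  ≡⟨ regroup (ascending n) n ⟩
    1 + g * (h * ascending n + n)      ≡⟨ cong (λ t → 1 + g * t) (h*ascending+n≡rep n) ⟩
    1 + g * rep n                      ≡⟨ rep-suc n ⟨
    rep (suc n)                        ∎
    where
    open ≡-Reasoning
    regroup : ∀ a n → h * (suc h * a + n) + suc n ≡ 1 + suc h * (h * a + n)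
    regroup a n = solve (h ∷ a ∷ n ∷ [])

  x₀≡ascending : x₀ g ≡ ascending g
  x₀≡ascending = trans (shifted g 0 (+-identityʳ g)) (+-identityʳ (ascending g))
    where
    shifted : ∀ n t → n + t ≡ g → sumBelow n (λ j → j * g ^ (h ∸ j)) ≡ g ^ t * ascending n
    shifted zero    t _     = sym (*-zeroʳ (g ^ t))
    shifted (suc n) t n+t≡h = begin
      sumBelow n (λ j → j * g ^ (h ∸ j)) + n * g ^ (h ∸ n)   ≡⟨ cong₂ _+_ (shifted n (suc t) (trans (+-suc n t) n+t≡h))
                                                                          (cong (λ e → n * g ^ e) h∸n≡t) ⟩
      g ^ suc t * ascending n + n * g ^ t  ≡⟨ regroup (g ^ t) (ascending n) n ⟩
      g ^ t * (g * ascending n + n)        ∎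
      where
      open ≡-Reasoning
      h∸n≡t : h ∸ n ≡ t
      h∸n≡t = trans (cong (_∸ n) (suc-injective (sym n+t≡h))) (m+n∸m≡n n t)
      regroup : ∀ p a n → suc h * p * a + n * p ≡ p * (suc h * a + n)
      regroup p a n = solve (h ∷ p ∷ a ∷ n ∷ [])

  rep-divisor-coprime : ∀ {e n} → e ∣ rep (suc n) → Coprime e g
  rep-divisor-coprime {n = n} e∣rep {c} (c∣e , c∣g) =
    ∣1⇒≡1 (∣m+n∣m⇒∣n (subst (c ∣_) (trans (rep-suc n) (+-comm 1 _)) (∣-trans c∣e e∣rep)) (∣-trans c∣g (m∣m*n (rep n))))

  fromDigits : (ℕ → ℕ) → ℕ → ℕ
  fromDigits b n = sumBelow n (λ j → b j * g ^ j)

  fromDigits≡digitSum+h* : ∀ b n → fromDigits b n ≡ sumBelow n b + h * sumBelow n (λ j → b j * rep j)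
  fromDigits≡digitSum+h* b zero    = sym (*-zeroʳ h)
  fromDigits≡digitSum+h* b (suc n) = begin
    fromDigits b n + b n * g ^ n         ≡⟨ cong₂ _+_ (fromDigits≡digitSum+h* b n) (cong (b n *_) (^≡1+h*rep n)) ⟩
    (s + h * w) + b n * (1 + h * rep n)  ≡⟨ regroup s w (b n) (rep n) ⟩
    (s + b n) + h * (w + b n * rep n)    ∎
    where
    open ≡-Reasoning
    s w : ℕ
    s = sumBelow n b
    w = sumBelow n (λ j → b j * rep j)
    regroup : ∀ s w c r → (s + h * w) + c * (1 + h * r) ≡ (s + c) + h * (w + c * r)
    regroup s w c r = solve (h ∷ s ∷ w ∷ c ∷ r ∷ [])

  digitSum≡0⇒fromDigits≡0 : ∀ b n → sumBelow n b ≡ 0 → fromDigits b n ≡ 0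
  digitSum≡0⇒fromDigits≡0 b zero    _  = refl
  digitSum≡0⇒fromDigits≡0 b (suc n) eq =
    cong₂ _+_ (digitSum≡0⇒fromDigits≡0 b n (m+n≡0⇒m≡0 (sumBelow n b) eq))
              (cong (_* g ^ n) (m+n≡0⇒n≡0 (sumBelow n b) eq))

  digitSum≡n⇒fromDigits≡rep : ∀ {b} → Bits b → ∀ n → sumBelow n b ≡ n → fromDigits b n ≡ rep n
  digitSum≡n⇒fromDigits≡rep bits zero _ = refl
  digitSum≡n⇒fromDigits≡rep {b} bits (suc n) eq with b n | bits n
  ... | 0 | _ = contradiction (subst (_≤ n) (trans (sym (+-identityʳ _)) eq) (digitSum≤length bits n)) 1+n≰n
  ... | 1 | _ = cong₂ _+_ (digitSum≡n⇒fromDigits≡rep bits n sum≡n) (+-identityʳ (g ^ n))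
    where
    sum≡n : sumBelow n b ≡ n
    sum≡n = suc-injective (trans (+-comm 1 _) eq)
  ... | 2+ _ | s≤s ()

  digitSum≡n⇒fromDigits+g^k≡rep : ∀ {b} → Bits b → ∀ n → sumBelow (suc n) b ≡ n →
                                  ∃[ k ] k < suc n × fromDigits b (suc n) + g ^ k ≡ rep (suc n)
  digitSum≡n⇒fromDigits+g^k≡rep {b} bits n eq with b n | bits n
  ... | 0 | _ = n , ≤-refl , cong₂ _+_ (trans (+-identityʳ _) (digitSum≡n⇒fromDigits≡rep bits n sum≡n)) refl
    where
    sum≡n : sumBelow n b ≡ n
    sum≡n = trans (sym (+-identityʳ _)) eq
  digitSum≡n⇒fromDigits+g^k≡rep bits zero    () | 1 | _
  digitSum≡n⇒fromDigits+g^k≡rep {b} bits (suc n) eq | 1 | _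
    with digitSum≡n⇒fromDigits+g^k≡rep bits n (suc-injective (trans (+-comm 1 _) eq))
  ... | k , k<1+n , fromDigits+g^k≡rep = k , m<n⇒m<1+n k<1+n , (begin
    fromDigits b (suc n) + 1 * g ^ suc n + g ^ k  ≡⟨ swap (fromDigits b (suc n)) (g ^ suc n) (g ^ k) ⟩
    (fromDigits b (suc n) + g ^ k) + g ^ suc n    ≡⟨ cong (_+ g ^ suc n) fromDigits+g^k≡rep ⟩
    rep (suc n) + g ^ suc n                       ∎)
    where
    open ≡-Reasoning
    swap : ∀ v p q → v + 1 * p + q ≡ (v + q) + p
    swap v p q = solve (v ∷ p ∷ q ∷ [])
  digitSum≡n⇒fromDigits+g^k≡rep bits n eq | 2+ _ | s≤s ()

  module _ .{{_ : NonZero h}} where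

    1<g : 1 < g
    1<g = s≤s (>-nonZero⁻¹ h)

    g*≢g*+rep : ∀ a b n → g * a ≢ g * b + rep (suc n)
    g*≢g*+rep a b n eq = 0≢1+n (mod-unique g a (b + rep n) (s≤s z≤n) 1<g (begin
      a * g                    ≡⟨ *-comm a g ⟩
      g * a                    ≡⟨ eq ⟩
      g * b + rep (suc n)      ≡⟨ cong (λ t → g * b + t) (rep-suc n) ⟩
      g * b + (1 + g * rep n)  ≡⟨ shuffle b (rep n) ⟩
      1 + (b + rep n) * g      ∎))
      where
      open ≡-Reasoning
      shuffle : ∀ b r → g * b + (1 + g * r) ≡ 1 + (b + r) * g
      shuffle b r = solve (h ∷ b ∷ r ∷ [])

    fromDigits<g^n : ∀ {b} → Bits b → ∀ n → fromDigits b n < g ^ n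
    fromDigits<g^n     bits zero    = s≤s z≤n
    fromDigits<g^n {b} bits (suc n) =
      +-mono-<-≤ (fromDigits<g^n bits n) (*-monoˡ-≤ (g ^ n) (≤-trans (bits n) (>-nonZero⁻¹ h)))

    orbit-expansion : ∀ D (y b : ℕ → ℕ) → (∀ j → g * y (suc j) ≡ y j + D * b j) →
                      ∀ n → g ^ n * y n ≡ y 0 + D * fromDigits b n
    orbit-expansion D y b step zero    = cong (λ t → y 0 + t) (sym (*-zeroʳ D))
    orbit-expansion D y b step (suc n) = begin
      g * g ^ n * y (suc n)                         ≡⟨ swap g (g ^ n) (y (suc n)) ⟩
      g ^ n * (g * y (suc n))                       ≡⟨ cong (g ^ n *_) (step n) ⟩
      g ^ n * (y n + D * b n)                       ≡⟨ *-distribˡ-+ (g ^ n) (y n) (D * b n) ⟩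
      g ^ n * y n + g ^ n * (D * b n)               ≡⟨ cong (_+ g ^ n * (D * b n)) (orbit-expansion D y b step n) ⟩
      y 0 + D * fromDigits b n + g ^ n * (D * b n)  ≡⟨ regroup (y 0) (fromDigits b n) (g ^ n) (b n) ⟩
      y 0 + D * (fromDigits b n + b n * g ^ n)      ∎
      where
      open ≡-Reasoning
      swap : ∀ a p t → a * p * t ≡ p * (a * t)
      swap a p t = solve (a ∷ p ∷ t ∷ [])
      regroup : ∀ y₀ v p c → y₀ + D * v + p * (D * c) ≡ y₀ + D * (v + c * p)
      regroup y₀ v p c = solve (D ∷ y₀ ∷ v ∷ p ∷ c ∷ [])

    -- Unrolling n steps gives g^n · y n = y 0 + (g^n − 1) · fromDigits b n; both y 0 and
    -- fromDigits b n are below g^n, so reducing modulo g^n identifies them.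
    orbit-start≡fromDigits : ∀ {D} n (y b : ℕ → ℕ) → Bits b → g ^ n ≡ suc D →
                             (∀ j → g * y (suc j) ≡ y j + D * b j) → y 0 ≤ D → y 0 ≡ fromDigits b n
    orbit-start≡fromDigits {D} n y b bits g^n≡1+D step y₀≤D =
      mod-unique (suc D) (fromDigits b n) (y n) (s≤s y₀≤D)
                 (subst (fromDigits b n <_) g^n≡1+D (fromDigits<g^n bits n)) (begin
        y 0 + fromDigits b n * suc D                 ≡⟨ regroup₁ (y 0) (fromDigits b n) ⟩
        (y 0 + D * fromDigits b n) + fromDigits b n  ≡⟨ cong (_+ fromDigits b n) (orbit-expansion D y b step n) ⟨
        g ^ n * y n + fromDigits b n                 ≡⟨ cong (λ p → p * y n + fromDigits b n) g^n≡1+D ⟩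
        suc D * y n + fromDigits b n                 ≡⟨ regroup₂ (y n) (fromDigits b n) ⟩
        fromDigits b n + y n * suc D                 ∎)
      where
      open ≡-Reasoning
      regroup₁ : ∀ y₀ v → y₀ + v * suc D ≡ (y₀ + D * v) + v
      regroup₁ y₀ v = solve (D ∷ y₀ ∷ v ∷ [])
      regroup₂ : ∀ yₙ v → suc D * yₙ + v ≡ v + yₙ * suc D
      regroup₂ yₙ v = solve (D ∷ yₙ ∷ v ∷ [])

-- At a maximal point x, g·x = x′ + l ≤ x + d gives h·x ≤ d; at a minimal one, h·x ≥ 0.
module CyclePoints {h d : ℕ} .{{_ : NonZero h}} (C : ExtremeCycle (suc h) d) where

  open Radix h using (g)

  private
    X : Fin (suc (k C)) → ℤ
    X = x C

    step-from-predecessor : ∀ i → ∃ λ p → + g ℤ.* X i ≡ X p ℤ.+ l C p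
    step-from-predecessor i with next-surjective i
    ... | p , refl = p , step C p

    digit-nonneg : ∀ i → + 0 ℤ.≤ l C i
    digit-nonneg i with digit C i
    ... | inj₁ e = ℤP.≤-reflexive (sym e)
    ... | inj₂ e = subst (+ 0 ℤ.≤_) (sym e) (ℤ.+≤+ z≤n)

    digit≤d : ∀ i → l C i ℤ.≤ + d
    digit≤d i with digit C i
    ... | inj₁ e = subst (ℤ._≤ + d) (sym e) (ℤ.+≤+ z≤n)
    ... | inj₂ e = ℤP.≤-reflexive e

    minimal-point-nonneg : ∀ b → (∀ j → X b ℤ.≤ X j) → + 0 ℤ.≤ X b
    minimal-point-nonneg b X[b]≤ with step-from-predecessor b
    ... | p , g*X[b]≡ = ℤP.*-cancelˡ-≤-pos (+ 0) (X b) (+ h) {{ℤ.positive (ℤ.+<+ (>-nonZero⁻¹ h))}}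
      (subst (ℤ._≤ + h ℤ.* X b) (sym (ℤP.*-zeroʳ (+ h))) (+-cancelˡ-≤ℤ (X b) (begin
        X b ℤ.+ + 0          ≤⟨ ℤP.+-mono-≤ (X[b]≤ p) (digit-nonneg p) ⟩
        X p ℤ.+ l C p        ≡⟨ g*X[b]≡ ⟨
        + g ℤ.* X b          ≡⟨ ℤP.suc-* (+ h) (X b) ⟩
        X b ℤ.+ + h ℤ.* X b  ∎)))
      where open ℤP.≤-Reasoning

    h*maximal-point≤d : ∀ a → (∀ j → X j ℤ.≤ X a) → + h ℤ.* X a ℤ.≤ + d
    h*maximal-point≤d a X≤X[a] with step-from-predecessor a
    ... | p , g*X[a]≡ = +-cancelˡ-≤ℤ (X a) (begin
      X a ℤ.+ + h ℤ.* X a  ≡⟨ ℤP.suc-* (+ h) (X a) ⟨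
      + g ℤ.* X a          ≡⟨ g*X[a]≡ ⟩
      X p ℤ.+ l C p        ≤⟨ ℤP.+-mono-≤ (X≤X[a] p) (digit≤d p) ⟩
      X a ℤ.+ + d          ∎)
      where open ℤP.≤-Reasoning

  point-nonneg : ∀ i → + 0 ℤ.≤ X i
  point-nonneg i with minimum-attained X
  ... | b , X[b]≤ = ℤP.≤-trans (minimal-point-nonneg b X[b]≤) (X[b]≤ i)

  h*point≤d : ∀ i → + h ℤ.* X i ℤ.≤ + d
  h*point≤d i with maximum-attained X
  ... | a , X≤X[a] = ℤP.≤-trans (ℤP.*-monoˡ-≤-nonNeg (+ h) (X≤X[a] i)) (h*maximal-point≤d a X≤X[a])

  N : Fin (suc (k C)) → ℕ
  N i = ∣ X i ∣

  x≡+N : ∀ i → X i ≡ + N i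
  x≡+N i = sym (ℤP.0≤i⇒+∣i∣≡i (point-nonneg i))

  h*N≤d : ∀ i → h * N i ≤ d
  h*N≤d i = ℤP.drop‿+≤+ (subst (ℤ._≤ + d) (trans (cong (+ h ℤ.*_) (x≡+N i)) (sym (ℤP.pos-* h (N i)))) (h*point≤d i))

  bit : Fin (suc (k C)) → ℕ
  bit i = [ (λ _ → 0) , (λ _ → 1) ]′ (digit C i)

  bit≤1 : ∀ i → bit i ≤ 1
  bit≤1 i with digit C i
  ... | inj₁ _ = z≤n
  ... | inj₂ _ = ≤-refl

  private
    step-with : ∀ i {e} → l C i ≡ + e → g * N (next i) ≡ N i + e
    step-with i {e} l≡e = ℤP.+-injective (begin
      + (g * N (next i))    ≡⟨ ℤP.pos-* g (N (next i)) ⟩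
      + g ℤ.* + N (next i)  ≡⟨ cong (+ g ℤ.*_) (x≡+N (next i)) ⟨
      + g ℤ.* X (next i)    ≡⟨ step C i ⟩
      X i ℤ.+ l C i         ≡⟨ cong₂ ℤ._+_ (x≡+N i) l≡e ⟩
      + N i ℤ.+ + e         ≡⟨ ℤP.pos-+ (N i) e ⟨
      + (N i + e)           ∎)
      where open ≡-Reasoning

  N-step : ∀ i → g * N (next i) ≡ N i + d * bit i
  N-step i = by-digit (digit C i)
    where
    by-digit : (δ : l C i ≡ + 0 ⊎ l C i ≡ + d) → g * N (next i) ≡ N i + d * [ (λ _ → 0) , (λ _ → 1) ]′ δ
    by-digit (inj₁ l≡0) = trans (step-with i l≡0) (cong (λ t → N i + t) (sym (*-zeroʳ d)))
    by-digit (inj₂ l≡d) = trans (step-with i l≡d) (cong (λ t → N i + t) (sym (*-identityʳ d)))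

  N-step-cases : ∀ i → g * N (next i) ≡ N i ⊎ g * N (next i) ≡ N i + d
  N-step-cases i with digit C i
  ... | inj₁ l≡0 = inj₁ (trans (step-with i l≡0) (+-identityʳ (N i)))
  ... | inj₂ l≡d = inj₂ (step-with i l≡d)

scale : ∀ {g d d′} e .{{_ : NonZero e}} → d′ ≡ e * d → ExtremeCycle g d → ExtremeCycle g d′
scale {g} {d} {d′} e d′≡e*d C = record
  { k     = k C
  ; x     = λ i → + e ℤ.* x C i
  ; l     = λ i → + e ℤ.* l C i
  ; digit = λ i → Sum.map scaled-0 scaled-d (digit C i)
  ; dist  = λ eq → dist C (ℤP.*-cancelˡ-≡ (+ e) _ _ eq)
  ; step  = scaled-step
  }
  where
  scaled-0 : ∀ {t} → t ≡ + 0 → + e ℤ.* t ≡ + 0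
  scaled-0 refl = ℤP.*-zeroʳ (+ e)
  scaled-d : ∀ {t} → t ≡ + d → + e ℤ.* t ≡ + d′
  scaled-d refl = trans (sym (ℤP.pos-* e d)) (cong +_ (sym d′≡e*d))
  scaled-step : ∀ i → + g ℤ.* (+ e ℤ.* x C (next i)) ≡ + e ℤ.* x C i ℤ.+ + e ℤ.* l C i
  scaled-step i = begin
    + g ℤ.* (+ e ℤ.* x C (next i))   ≡⟨ swap (+ g) (+ e) (x C (next i)) ⟩
    + e ℤ.* (+ g ℤ.* x C (next i))   ≡⟨ cong (+ e ℤ.*_) (step C i) ⟩
    + e ℤ.* (x C i ℤ.+ l C i)        ≡⟨ ℤP.*-distribˡ-+ (+ e) (x C i) (l C i) ⟩
    + e ℤ.* x C i ℤ.+ + e ℤ.* l C i  ∎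
    where
    open ≡-Reasoning
    swap : ∀ a b t → a ℤ.* (b ℤ.* t) ≡ b ℤ.* (a ℤ.* t)
    swap a b t = ℤSolver.solve (a ∷ b ∷ t ∷ [])

module RepunitCycle (h : ℕ) .{{_ : NonZero h}} where

  open Radix h

  m : ℕ
  m = rep g

  repSum : ℕ
  repSum = sumBelow g rep

  -- q k = (m − g^k)/h, written without division: g^j = 1 + h·rep j turns m into 1 + h·(1 + repSum).
  q : ℕ → ℕ
  q k = suc repSum ∸ rep k

  m≡1+h*[1+repSum] : m ≡ 1 + h * suc repSum
  m≡1+h*[1+repSum] = trans (rep≡n+h*sumBelow-rep g) (cong suc (sym (*-suc h repSum)))

  q-spec : ∀ {k} → k < g → h * q k + g ^ k ≡ m
  q-spec {k} k<g = begin
    h * q k + g ^ k            ≡⟨ cong (λ t → h * q k + t) (^≡1+h*rep k) ⟩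
    h * q k + (1 + h * rep k)  ≡⟨ regroup (q k) (rep k) ⟩
    1 + h * (rep k + q k)      ≡⟨ cong (λ t → 1 + h * t) (m+[n∸m]≡n (≤-trans (term≤sumBelow rep k<g) (n≤1+n repSum))) ⟩
    1 + h * suc repSum         ≡⟨ m≡1+h*[1+repSum] ⟨
    m                          ∎
    where
    open ≡-Reasoning
    regroup : ∀ a r → h * a + (1 + h * r) ≡ 1 + h * (r + a)
    regroup a r = solve (h ∷ a ∷ r ∷ [])

  h*-+-cancel : ∀ {a b} c → h * a + c ≡ h * b + c → a ≡ b
  h*-+-cancel {a} {b} c eq = *-cancelˡ-≡ a b h (+-cancelʳ-≡ c (h * a) (h * b) eq)

  q-unique : ∀ {a k} → k < g → h * a + g ^ k ≡ m → a ≡ q k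
  q-unique {k = k} k<g eq = h*-+-cancel (g ^ k) (trans eq (sym (q-spec k<g)))

  q-injective : ∀ {j k} → j < g → k < g → q j ≡ q k → j ≡ k
  q-injective {j} {k} j<g k<g qj≡qk = ^-injective g 1<g (+-cancelˡ-≡ (h * q j) (g ^ j) (g ^ k) (begin
    h * q j + g ^ j  ≡⟨ q-spec j<g ⟩
    m                ≡⟨ q-spec k<g ⟨
    h * q k + g ^ k  ≡⟨ cong (λ t → h * t + g ^ k) qj≡qk ⟨
    h * q j + g ^ k  ∎))
    where open ≡-Reasoning

  h*[g*q]+g^[1+k]≡g*m : ∀ {k} → k < g → h * (g * q k) + g ^ suc k ≡ g * m
  h*[g*q]+g^[1+k]≡g*m {k} k<g = trans (regroup h g (q k) (g ^ k)) (cong (g *_) (q-spec k<g))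
    where
    regroup : ∀ a c b p → a * (c * b) + c * p ≡ c * (a * b + p)
    regroup a c b p = solve (a ∷ c ∷ b ∷ p ∷ [])

  q-step : ∀ {k} → suc k < g → g * q k ≡ q (suc k) + m
  q-step {k} 1+k<g = h*-+-cancel (g ^ suc k) (begin
    h * (g * q k) + g ^ suc k          ≡⟨ h*[g*q]+g^[1+k]≡g*m (<-trans (n<1+n k) 1+k<g) ⟩
    m + h * m                          ≡⟨ cong (_+ h * m) (q-spec 1+k<g) ⟨
    h * q (suc k) + g ^ suc k + h * m  ≡⟨ regroup h (q (suc k)) m (g ^ suc k) ⟩
    h * (q (suc k) + m) + g ^ suc k    ∎)
    where
    open ≡-Reasoning
    regroup : ∀ a b c p → a * b + p + a * c ≡ a * (b + c) + p
    regroup a b c p = solve (a ∷ b ∷ c ∷ p ∷ [])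

  q-wrap : g * q h ≡ q 0
  q-wrap = h*-+-cancel (g ^ g) (begin
    h * (g * q h) + g ^ g  ≡⟨ h*[g*q]+g^[1+k]≡g*m (n<1+n h) ⟩
    m + h * m              ≡⟨ cong (_+ h * m) (q-spec (s≤s z≤n)) ⟨
    h * q 0 + 1 + h * m    ≡⟨ +-assoc (h * q 0) 1 (h * m) ⟩
    h * q 0 + (1 + h * m)  ≡⟨ cong (λ t → h * q 0 + t) (^≡1+h*rep g) ⟨
    h * q 0 + g ^ g        ∎)
    where open ≡-Reasoning

  g*≢g*+m : ∀ a b → g * a ≢ g * b + m
  g*≢g*+m a b = g*≢g*+rep a b h

  q₁≢0 : q 1 ≢ 0
  q₁≢0 q₁≡0 = g*≢g*+m 1 0 (begin
    g * 1            ≡⟨ cong (_+ g * 1) (*-zeroʳ h) ⟨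
    h * 0 + g * 1    ≡⟨ cong (λ t → h * t + g * 1) q₁≡0 ⟨
    h * q 1 + g * 1  ≡⟨ q-spec 1<g ⟩
    m                ≡⟨ cong (_+ m) (*-zeroʳ g) ⟨
    g * 0 + m        ∎)
    where open ≡-Reasoning

  x₀≡q₁ : x₀ g ≡ q 1
  x₀≡q₁ = q-unique 1<g (begin
    h * x₀ g + g * 1     ≡⟨ cong₂ (λ a b → h * a + b) x₀≡ascending (*-identityʳ g) ⟩
    h * ascending g + g  ≡⟨ h*ascending+n≡rep g ⟩
    m                    ∎)
    where open ≡-Reasoning

  C₀-digit : Fin g → ℤ
  C₀-digit j with toℕ j ≟ h
  ... | yes _ = + 0
  ... | no  _ = + m

  C₀ : ExtremeCycle g m
  C₀ = record
    { k     = h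
    ; x     = λ j → + q (h ∸ toℕ j)
    ; l     = C₀-digit
    ; digit = C₀-digit∈
    ; dist  = C₀-injective
    ; step  = C₀-step
    }
    where
    toℕ≤h : ∀ (j : Fin g) → toℕ j ≤ h
    toℕ≤h j = ≤-pred (toℕ<n j)

    C₀-digit∈ : ∀ j → C₀-digit j ≡ + 0 ⊎ C₀-digit j ≡ + m
    C₀-digit∈ j with toℕ j ≟ h
    ... | yes _ = inj₁ refl
    ... | no  _ = inj₂ refl

    C₀-injective : ∀ {i j} → + q (h ∸ toℕ i) ≡ + q (h ∸ toℕ j) → i ≡ j
    C₀-injective {i} {j} eq = toℕ-injective (∸-cancelˡ-≡ (toℕ≤h i) (toℕ≤h j)
      (q-injective (s≤s (m∸n≤m h (toℕ i))) (s≤s (m∸n≤m h (toℕ j))) (ℤP.+-injective eq)))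

    lift : ∀ {a} b c → g * a ≡ b + c → + g ℤ.* + a ≡ + b ℤ.+ + c
    lift {a} b c eq = trans (sym (ℤP.pos-* g a)) (trans (cong +_ eq) (ℤP.pos-+ b c))

    C₀-step : ∀ j → + g ℤ.* + q (h ∸ toℕ (next j)) ≡ + q (h ∸ toℕ j) ℤ.+ C₀-digit j
    C₀-step j with toℕ j ≟ h | next-spec j
    ... | yes j≡h | inj₁ next≡1+j     =
      contradiction (subst (_≤ h) (trans next≡1+j (cong suc j≡h)) (toℕ≤h (next j))) 1+n≰n
    ... | no  j≢h | inj₂ (j≡h , _)    = contradiction j≡h j≢h
    ... | yes j≡h | inj₂ (_ , next≡0) = wrap (toℕ j) (toℕ (next j)) j≡h (cong toℕ next≡0)
      where
      wrap : ∀ a b → a ≡ h → b ≡ 0 → + g ℤ.* + q (h ∸ b) ≡ + q (h ∸ a) ℤ.+ + 0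
      wrap _ _ refl refl = lift (q (h ∸ h)) 0 (trans q-wrap (sym (trans (+-identityʳ (q (h ∸ h))) (cong q (n∸n≡0 h)))))
    ... | no  j≢h | inj₁ next≡1+j     = advance (toℕ j) (toℕ (next j)) next≡1+j (≤∧≢⇒< (toℕ≤h j) j≢h)
      where
      advance : ∀ a b → b ≡ suc a → a < h → + g ℤ.* + q (h ∸ b) ≡ + q (h ∸ a) ℤ.+ + m
      advance a _ refl a<h rewrite ∸-suc a<h =
        lift (q (suc (h ∸ suc a))) m (q-step (s≤s (subst (_≤ h) (∸-suc a<h) (m∸n≤m h a))))

  q∈C₀ : ∀ {t} → t < g → (+ q t) ∈C C₀
  q∈C₀ {t} t<g = fromℕ< h∸t<g , (begin
    + q (h ∸ toℕ (fromℕ< h∸t<g))  ≡⟨ cong (λ u → + q (h ∸ u)) (toℕ-fromℕ< h∸t<g) ⟩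
    + q (h ∸ (h ∸ t))             ≡⟨ cong (λ u → + q u) (m∸[m∸n]≡n (≤-pred t<g)) ⟩
    + q t                         ∎)
    where
    open ≡-Reasoning
    h∸t<g : h ∸ t < g
    h∸t<g = s≤s (m∸n≤m h t)

  x₀∈C₀ : (+ x₀ g) ∈C C₀
  x₀∈C₀ = subst (_∈C C₀) (cong +_ (sym x₀≡q₁)) (q∈C₀ 1<g)

  C₀-nontrivial : ¬ Trivial C₀
  C₀-nontrivial trivial with q∈C₀ 1<g
  ... | i , x≡q₁ = q₁≢0 (ℤP.+-injective (trans (sym x≡q₁) (trivial i)))

  module Cycle (C : ExtremeCycle g m) where

    open CyclePoints C public

    zero-point⇒trivial : ∀ i → N i ≡ 0 → Trivial C
    zero-point⇒trivial i N≡0 j = begin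
      x C j  ≡⟨ cong (x C) (next-fixed⇒unique next-fixed j) ⟩
      x C i  ≡⟨ x≡+N i ⟩
      + N i  ≡⟨ cong +_ N≡0 ⟩
      + 0    ∎
      where
      open ≡-Reasoning
      N≡g*0 : N i ≡ g * 0
      N≡g*0 = trans N≡0 (sym (*-zeroʳ g))
      N[next]≡0 : N (next i) ≡ 0
      N[next]≡0 with N-step-cases i
      ... | inj₁ e = *-cancelˡ-≡ (N (next i)) 0 g (trans e N≡g*0)
      ... | inj₂ e = contradiction (trans e (cong (_+ m) N≡g*0)) (g*≢g*+m (N (next i)) 0)
      next-fixed : next i ≡ i
      next-fixed = dist C (trans (x≡+N (next i)) (trans (cong +_ (trans N[next]≡0 (sym N≡0))) (sym (x≡+N i))))

    successor-of-q : ∀ {i t} → suc t < g → N i ≡ q (suc t) → N (next i) ≡ q t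
    successor-of-q {i} {t} 1+t<g N≡q with N-step-cases i
    ... | inj₁ e = contradiction (trans (q-step 1+t<g) (cong (_+ m) (sym (trans e N≡q)))) (g*≢g*+m (q t) (N (next i)))
    ... | inj₂ e = *-cancelˡ-≡ (N (next i)) (q t) g (trans e (trans (cong (_+ m) N≡q) (sym (q-step 1+t<g))))

    successor-of-q₀ : ∀ {i} → N i ≡ q 0 → N (next i) ≡ q h
    successor-of-q₀ {i} N≡q with N-step-cases i
    ... | inj₁ e = *-cancelˡ-≡ (N (next i)) (q h) g (trans e (trans N≡q (sym q-wrap)))
    ... | inj₂ e = contradiction (trans e (cong (_+ m) (trans N≡q (sym q-wrap)))) (g*≢g*+m (N (next i)) (q h))

    Hits : ℕ → Set
    Hits t = ∃ λ i → N i ≡ q t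

    hit⇒∈C : ∀ t → Hits t → (+ q t) ∈C C
    hit⇒∈C _ (i , N≡q) = i , trans (x≡+N i) (cong +_ N≡q)

    hits-below : ∀ {t} → t < g → Hits t → ∀ u → u ≤ t → Hits u
    hits-below {zero}  _     hit       .zero z≤n   = hit
    hits-below {suc t} 1+t<g (i , N≡q) u     u≤1+t with m≤n⇒m<n∨m≡n u≤1+t
    ... | inj₂ refl  = i , N≡q
    ... | inj₁ u<1+t = hits-below (<-trans (n<1+n t) 1+t<g) (next i , successor-of-q 1+t<g N≡q) u (≤-pred u<1+t)

    hits-all : ∀ {t} → t < g → Hits t → ∀ u → u < g → Hits u
    hits-all t<g hit u u<g with hits-below t<g hit 0 z≤n
    ... | i , N≡q₀ = hits-below (n<1+n h) (next i , successor-of-q₀ N≡q₀) u (≤-pred u<g)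

    orbit-bits : Fin (suc (k C)) → ℕ → ℕ
    orbit-bits i j = bit (fold i next j)

    orbit-bits≤1 : ∀ i → Bits (orbit-bits i)
    orbit-bits≤1 i j = bit≤1 (fold i next j)

    h*N≡fromDigits : ∀ i → h * N i ≡ fromDigits (orbit-bits i) g
    h*N≡fromDigits i = orbit-start≡fromDigits {h * m} g (λ j → h * N (fold i next j)) (orbit-bits i)
      (orbit-bits≤1 i) (^≡1+h*rep g) (λ j → scaled (N-step (fold i next j)))
      (≤-trans (h*N≤d i) (m≤n*m m h))
      where
      scaled : ∀ {p n b} → g * p ≡ n + m * b → g * (h * p) ≡ h * n + h * m * b
      scaled {p} {n} {b} eq = begin
        g * (h * p)        ≡⟨ swap g h p ⟩
        h * (g * p)        ≡⟨ cong (h *_) eq ⟩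
        h * (n + m * b)    ≡⟨ distrib h n m b ⟩
        h * n + h * m * b  ∎
        where
        open ≡-Reasoning
        swap : ∀ a c p → a * (c * p) ≡ c * (a * p)
        swap a c p = solve (a ∷ c ∷ p ∷ [])
        distrib : ∀ a n c b → a * (n + c * b) ≡ a * n + a * c * b
        distrib a n c b = solve (a ∷ n ∷ c ∷ b ∷ [])

    h∣digitSum : ∀ i → h ∣ sumBelow g (orbit-bits i)
    h∣digitSum i = ∣m+n∣m⇒∣n (subst (h ∣_) h*N≡W+s (m∣m*n (N i))) (m∣m*n W)
      where
      W : ℕ
      W = sumBelow g (λ j → orbit-bits i j * rep j)
      h*N≡W+s : h * N i ≡ h * W + sumBelow g (orbit-bits i)
      h*N≡W+s = trans (h*N≡fromDigits i) (trans (fromDigits≡digitSum+h* (orbit-bits i) g) (+-comm (sumBelow g (orbit-bits i)) (h * W)))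

    module _ (2≤h : 2 ≤ h) where

      point-classification : ∀ i → N i ≡ 0 ⊎ ∃[ k ] k < g × N i ≡ q k
      point-classification i = Sum.map digitSum≡0⇒N≡0 digitSum≡h⇒N≡q
        (h∣s≤1+h⇒s≡0∨s≡h 2≤h (h∣digitSum i) (digitSum≤length (orbit-bits≤1 i) g))
        where
        digitSum≡0⇒N≡0 : sumBelow g (orbit-bits i) ≡ 0 → N i ≡ 0
        digitSum≡0⇒N≡0 sum≡0 = *-cancelˡ-≡ (N i) 0 h (begin
          h * N i                      ≡⟨ h*N≡fromDigits i ⟩
          fromDigits (orbit-bits i) g  ≡⟨ digitSum≡0⇒fromDigits≡0 (orbit-bits i) g sum≡0 ⟩
          0                            ≡⟨ *-zeroʳ h ⟨
          h * 0                        ∎)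
          where open ≡-Reasoning
        gap⇒N≡q : ∃[ k ] k < g × fromDigits (orbit-bits i) g + g ^ k ≡ m → ∃[ k ] k < g × N i ≡ q k
        gap⇒N≡q (k , k<g , fromDigits+g^k≡m) =
          k , k<g , q-unique k<g (trans (cong (_+ g ^ k) (h*N≡fromDigits i)) fromDigits+g^k≡m)
        digitSum≡h⇒N≡q : sumBelow g (orbit-bits i) ≡ h → ∃[ k ] k < g × N i ≡ q k
        digitSum≡h⇒N≡q sum≡h = gap⇒N≡q (digitSum≡n⇒fromDigits+g^k≡rep (orbit-bits≤1 i) h sum≡h)

      nontrivial⇒points-are-q : ¬ Trivial C → ∀ i → ∃[ k ] k < g × N i ≡ q k
      nontrivial⇒points-are-q nontrivial i =
        [ (λ N≡0 → contradiction (zero-point⇒trivial i N≡0) nontrivial) , id ]′ (point-classification i)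

      nontrivial⇒hits : ¬ Trivial C → ∀ u → u < g → Hits u
      nontrivial⇒hits nontrivial = hits-from-zero (nontrivial⇒points-are-q nontrivial zero)
        where
        hits-from-zero : ∃[ k ] k < g × N zero ≡ q k → ∀ u → u < g → Hits u
        hits-from-zero (k , k<g , N≡q) = hits-all k<g (zero , N≡q)

  module _ (2≤h : 2 ≤ h) where

    nontrivial-cycle-is-C₀ : (C : ExtremeCycle g m) → ¬ Trivial C → ∀ y → (y ∈C C) ⇔ (y ∈C C₀)
    nontrivial-cycle-is-C₀ C nontrivial y = mk⇔ to from
      where
      open Cycle C
      to : y ∈C C → y ∈C C₀
      to (i , refl) = q-point⇒∈C₀ (nontrivial⇒points-are-q 2≤h nontrivial i)
        where
        q-point⇒∈C₀ : ∃[ k ] k < g × N i ≡ q k → x C i ∈C C₀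
        q-point⇒∈C₀ (k , k<g , N≡q) = subst (_∈C C₀) (trans (cong +_ (sym N≡q)) (sym (x≡+N i))) (q∈C₀ k<g)
      from : y ∈C C₀ → y ∈C C
      from (j , refl) = hit⇒∈C (h ∸ toℕ j) (nontrivial⇒hits 2≤h nontrivial (h ∸ toℕ j) (s≤s (m∸n≤m h (toℕ j))))

    proper-divisors-complete : ∀ d → d ∣ m → d ≢ m → Complete g d
    proper-divisors-complete d (divides zero m≡0) _ _ = contradiction (trans (sym (rep-suc h)) m≡0) λ ()
    proper-divisors-complete d (divides e@(suc _) m≡e*d) d≢m C i =
      [ e*N≡0⇒x≡0 , (λ q-point → contradiction (e≡1 q-point) e≢1) ]′ (Cycle.point-classification (scale e m≡e*d C) 2≤h i)
      where
      open CyclePoints C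
      N′≡e*N : CyclePoints.N (scale e m≡e*d C) i ≡ e * N i
      N′≡e*N = ℤP.abs-* (+ e) (x C i)
      e*N≡0⇒x≡0 : CyclePoints.N (scale e m≡e*d C) i ≡ 0 → x C i ≡ + 0
      e*N≡0⇒x≡0 eN≡0 = trans (x≡+N i) (cong +_ (*-cancelˡ-≡ (N i) 0 e (trans (sym N′≡e*N) (trans eN≡0 (sym (*-zeroʳ e))))))
      e∣m : e ∣ m
      e∣m = divides d (trans m≡e*d (*-comm e d))
      e≢1 : e ≢ 1
      e≢1 e≡1 = d≢m (sym (trans m≡e*d (trans (cong (_* d) e≡1) (+-identityʳ d))))
      e≡1 : ∃[ k ] k < g × CyclePoints.N (scale e m≡e*d C) i ≡ q k → e ≡ 1
      e≡1 (k , k<g , eN≡q) = ∣1⇒≡1 (coprime-∣^⇒∣1 (rep-divisor-coprime {n = h} e∣m) k e∣g^k)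
        where
        h*[e*N]+g^k≡m : h * (e * N i) + g ^ k ≡ m
        h*[e*N]+g^k≡m = trans (cong (λ t → h * t + g ^ k) (trans (sym N′≡e*N) eN≡q)) (q-spec k<g)
        e∣g^k : e ∣ g ^ k
        e∣g^k = ∣m+n∣m⇒∣n (subst (e ∣_) (sym h*[e*N]+g^k≡m) e∣m) (∣n⇒∣m*n h (m∣m*n (N i)))

theorem2p34 : (g : ℕ) → 4 ≤ g → 2 ∣ g →
    Primitive g (repunit g) ×
    Σ (ExtremeCycle g (repunit g)) (λ C₀ →
      length C₀ ≡ g ×
      (+ (x₀ g)) ∈C C₀ ×
      ((C : ExtremeCycle g (repunit g)) → ¬ Trivial C →
        (∀ y → (y ∈C C) ⇔ (y ∈C C₀))))
theorem2p34 (suc h@(suc _)) (s≤s 3≤h) _ =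
  ((C₀ , C₀-nontrivial) , proper-divisors-complete 2≤h) , C₀ , refl , x₀∈C₀ , nontrivial-cycle-is-C₀ 2≤h
  where
  open RepunitCycle h
  2≤h : 2 ≤ h
  2≤h = ≤-trans (n≤1+n 2) 3≤h
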